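{- For a natural number $n\ge 3$, $$\bar{\tau}(C_n)=\begin{cases}13 & \text{if } n=3,\\ 0 & \text{if } n \text{ is odd and } n\ge 5,\\ 2 & \text{otherwise},\end{cases}\qquad \hbar(C_n)=\begin{cases}4 & \text{if } n=3,\\ 0 & \text{if } n \text{ is odd and } n\ge 5,\\ 1 & \text{otherwise}.\end{cases}$$
   Context: $C_n$ is the cycle graph on $n$ vertices. For a topology $\mathcal{T}$ on a finite set $X$, its underlying graph is the simple graph on $X$ in which distinct $x,y$ are adjacent iff $x\in\overline{\{y\}}$ or $y\in\overline{\{x\}}$ (closures in $\mathcal{T}$). For a finite simple graph $G$, $\bar{\tau}(G)$ is the number of topologies on $V(G)$ whose underlying graph is exactly $G$, and $\hbar(G)$ is the number of pairwise non-homeomorphic such topologies. -}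

module Defs where

open import Data.Bool using (Bool; true; false; if_then_else_)
open import Data.Nat using (ℕ; zero; suc; _+_; _≡ᵇ_; _%_)
open import Data.Fin using (Fin; toℕ)
open import Data.Fin.Subset using (Subset; ⊥; ⊤; _∪_; _∩_; _∈_; ∁; ⁅_⁆)
open import Data.Fin.Permutation using (Permutation′; _⟨$⟩ʳ_)
open import Data.Vec using (tabulate; lookup)
open import Data.Product using (Σ; _×_; ∃; _,_)
open import Data.Sum using (_⊎_)
open import Relation.Binary.PropositionalEquality using (_≡_; _≢_)
open import Function.Bundles using (_⇔_)

-- A topology on the finite set Fin n, given by its (decidable) family of
-- open sets.  On a finite set closure under finite (binary + empty)
-- unions/intersections is closure under arbitrary ones.
record Topology (n : ℕ) : Set where
  field
    isOpen : Subset n → Bool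
    open-⊥ : isOpen ⊥ ≡ true
    open-⊤ : isOpen ⊤ ≡ true
    open-∪ : ∀ U V → isOpen U ≡ true → isOpen V ≡ true → isOpen (U ∪ V) ≡ true
    open-∩ : ∀ U V → isOpen U ≡ true → isOpen V ≡ true → isOpen (U ∩ V) ≡ true
open Topology public

_≈ᵀ_ : ∀ {n} → Topology n → Topology n → Set
T ≈ᵀ T' = ∀ U → isOpen T U ≡ isOpen T' U

IsClosed : ∀ {n} → Topology n → Subset n → Set
IsClosed T C = isOpen T (∁ C) ≡ true

InClosure : ∀ {n} → Topology n → Fin n → Subset n → Set
InClosure T x A = ∀ C → IsClosed T C → (∀ y → y ∈ A → y ∈ C) → x ∈ C

UAdj : ∀ {n} → Topology n → Fin n → Fin n → Set
UAdj T x y = x ≢ y × (InClosure T x ⁅ y ⁆ ⊎ InClosure T y ⁅ x ⁆)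

Graph : ℕ → Set₁
Graph n = Fin n → Fin n → Set

HasUnderlyingGraph : ∀ {n} → Topology n → Graph n → Set
HasUnderlyingGraph T G = ∀ x y → UAdj T x y ⇔ G x y

Cycle : (n : ℕ) → Graph n
Cycle n i j =
  (toℕ i + 1 ≡ toℕ j) ⊎ (toℕ j + 1 ≡ toℕ i)
  ⊎ (toℕ i ≡ 0 × toℕ j + 1 ≡ n) ⊎ (toℕ j ≡ 0 × toℕ i + 1 ≡ n)

preimage : ∀ {n} → Permutation′ n → Subset n → Subset n
preimage σ U = tabulate (λ i → lookup U (σ ⟨$⟩ʳ i))

Homeomorphic : ∀ {n} → Topology n → Topology n → Set
Homeomorphic {n} T T' =
  Σ (Permutation′ n) λ σ → ∀ U → isOpen T' U ≡ isOpen T (preimage σ U)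

-- The number of elements of A satisfying P, counted up to the equivalence ~,
-- is k: a list f 0,…,f (k-1) of elements satisfying P, pairwise
-- non-equivalent, such that every element satisfying P is equivalent to one.
CountUpTo : (A : Set) → (A → Set) → (A → A → Set) → ℕ → Set
CountUpTo A P _~_ k =
  Σ (Fin k → A) λ f →
    (∀ i → P (f i))
    × (∀ i j → f i ~ f j → i ≡ j)
    × (∀ a → P a → ∃ λ i → a ~ f i)

TauBar : ∀ {n} → Graph n → ℕ → Set
TauBar {n} G k = CountUpTo (Topology n) (λ T → HasUnderlyingGraph T G) _≈ᵀ_ k

HBar : ∀ {n} → Graph n → ℕ → Set
HBar {n} G k = CountUpTo (Topology n) (λ T → HasUnderlyingGraph T G) Homeomorphic k

byCases : ℕ → ℕ → ℕ → ℕ → ℕ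
byCases a b c n = if n ≡ᵇ 3 then a else (if n % 2 ≡ᵇ 1 then b else c)

module Submission where

-- A topology on a finite set is the Alexandrov topology (open = upward closed)
-- of its specialisation preorder x ≼ y ⇔ x ∈ cl{y}, and its underlying graph
-- is the comparability graph of that preorder (alexandrov-graph).  So we count
-- preorders whose comparability graph is C_n:
--
-- * n = 3: C₃ is complete, so the preorder is total.  A total preorder is
--   determined by the sizes of its down-sets (total⇒rankTop), which turns the
--   count into an exhaustive check over rank functions Fin 3 → Fin 4: there are
--   13 orders, falling into 4 homeomorphism classes told apart by whether some
--   singleton, resp. some co-singleton, is open (signature).
-- * n ≥ 4: vertices two steps apart are distinct and non-adjacent, so the
--   specialisation never goes two steps in the same direction; edges are
--   oriented alternately up and down (LongCycle).  Such an alternating labelling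
--   of the cycle exists only for even n, and then the topology is one of the
--   two zigzags, which are distinct but swapped by a rotation.

open import Defs
open import Data.Nat using (ℕ; _≤_)
open import Data.Product using (_×_)

open import Data.Bool using (Bool; true; false; not)
open import Data.Bool.Properties using (⇔→≡; not-involutive; not-¬) renaming (_≟_ to _≟ᵇ_)
open import Data.Nat using (zero; suc; _+_; _<_; _≤ᵇ_; _^_; _%_; _≡ᵇ_; z≤n; s≤s)
open import Data.Nat.Properties using (_≤?_; _<?_; ≤-refl; ≤-trans; ≤-total; <⇒≱; +-comm; 1+n≢n; suc-injective;
                                      ≤∧≮⇒≡; <-irrefl; <-trans; n<1+n; <⇒≢)
  renaming (_≟_ to _≟ℕ_)
open import Data.Fin using (Fin; zero; suc; toℕ; fromℕ; fromℕ<; inject₁; #_; finToFun; funToFin)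
open import Data.Fin.Properties using (_≟_; all?; any?; finToFun-funToFin; toℕ-injective; toℕ<n; toℕ-fromℕ; toℕ-fromℕ<; toℕ-inject₁)
open import Data.Fin.Subset using (Subset; ⊤; _∪_; _∩_; _∈_; _∉_; ∁; ⁅_⁆; _⊆_; _⊂_; ∣_∣) renaming (⊥ to ∅)
open import Data.Fin.Subset.Properties
  using (_∈?_; ∉⊥; ∈⊤; x∈p∪q⁺; x∈p∪q⁻; x∈p∩q⁺; x∈p∩q⁻; x∈⁅x⁆; x∈⁅y⁆⇒x≡y; x∈⁅y⁆⇔x≡y;
         x∈p⇒x∉∁p; x∈∁p⇒x∉p; x∉p⇒x∈∁p; ⊆-antisym; p⊆q⇒∣p∣≤∣q∣; p⊂q⇒∣p∣<∣q∣; ∣p∣≤n; anySubset?; ∪-∩-booleanAlgebra)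
open import Data.Fin.Permutation using (Permutation′; permutation; transpose; _∘ₚ_; _⟨$⟩ʳ_; _⟨$⟩ˡ_; inverseʳ; inverseˡ)
import Data.Fin.Permutation as Perm
open import Data.Vec using (Vec; []; _∷_; tabulate; lookup)
open import Data.Vec.Properties using (lookup∘tabulate; tabulate∘lookup; []=⇒lookup; lookup⇒[]=)
open import Data.Product using (∃; _,_; proj₁; proj₂)
open import Data.Product.Properties using () renaming (≡-dec to ×-≡-dec)
open import Data.Unit using (tt)
open import Data.Sum using (_⊎_; inj₁; inj₂) renaming (map to ⊎-map; swap to ⊎-swap)
open import Function using (_∘_)
open import Function.Bundles using (_⇔_; mk⇔; Equivalence)
open import Relation.Nullary using (¬_; Dec; yes; no; does; contradiction)
open import Relation.Nullary.Decidable using (_×-dec_; _⊎-dec_; _→-dec_; ¬?; dec-true; dec-false; does-⇔; toWitness)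
open import Relation.Binary.PropositionalEquality
import Algebra.Lattice.Properties.BooleanAlgebra as BooleanAlgebraProperties

open Equivalence using (to; from)

does⇔ : ∀ {A : Set} (a? : Dec A) → does a? ≡ true ⇔ A
does⇔ (yes a) = mk⇔ (λ _ → a) (λ _ → refl)
does⇔ (no ¬a) = mk⇔ (λ ()) (λ a → contradiction a ¬a)


∁-involutive : ∀ {n} (U : Subset n) → ∁ (∁ U) ≡ U
∁-involutive {n} = BooleanAlgebraProperties.¬-involutive (∪-∩-booleanAlgebra n)

∈⇔lookup : ∀ {n} {U : Subset n} {x} → x ∈ U ⇔ lookup U x ≡ true
∈⇔lookup {U = U} {x} = mk⇔ []=⇒lookup (lookup⇒[]= x U)

∈-tabulate : ∀ {n} (f : Fin n → Bool) {x} → x ∈ tabulate f ⇔ f x ≡ true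
∈-tabulate f {x} = mk⇔
  (λ x∈ → trans (sym (lookup∘tabulate f x)) (to ∈⇔lookup x∈))
  (λ fx → from ∈⇔lookup (trans (lookup∘tabulate f x) fx))

∈-filter : ∀ {n} {P : Fin n → Set} (P? : ∀ x → Dec (P x)) {x} → x ∈ tabulate (does ∘ P?) ⇔ P x
∈-filter P? {x} = mk⇔ (to (does⇔ (P? x)) ∘ to (∈-tabulate _)) (from (∈-tabulate _) ∘ from (does⇔ (P? x)))

∈-preimage : ∀ {n} (σ : Permutation′ n) (U : Subset n) {x} → x ∈ preimage σ U ⇔ σ ⟨$⟩ʳ x ∈ U
∈-preimage σ U = mk⇔ (from ∈⇔lookup ∘ to (∈-tabulate _)) (from (∈-tabulate _) ∘ to ∈⇔lookup)

⁅⁆⊆ : ∀ {n} {C : Subset n} {y} → y ∈ C → ∀ z → z ∈ ⁅ y ⁆ → z ∈ C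
⁅⁆⊆ {C = C} {y} y∈C z z∈⁅y⁆ = subst (_∈ C) (sym (x∈⁅y⁆⇒x≡y y z∈⁅y⁆)) y∈C

⋂ᶠ : ∀ {n k} → (Fin k → Subset n) → Subset n
⋂ᶠ {k = zero} F = ⊤
⋂ᶠ {k = suc k} F = F zero ∩ ⋂ᶠ (F ∘ suc)

⋃ᶠ : ∀ {n k} → (Fin k → Subset n) → Subset n
⋃ᶠ {k = zero} F = ∅
⋃ᶠ {k = suc k} F = F zero ∪ ⋃ᶠ (F ∘ suc)

∈⋂ᶠ : ∀ {n k} (F : Fin k → Subset n) {z} → z ∈ ⋂ᶠ F ⇔ (∀ i → z ∈ F i)
∈⋂ᶠ {k = zero} F = mk⇔ (λ _ ()) (λ _ → ∈⊤)
∈⋂ᶠ {k = suc k} F = mk⇔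
  (λ z∈ → let (z∈F₀ , z∈rest) = x∈p∩q⁻ _ _ z∈ in
    λ { zero → z∈F₀ ; (suc i) → to (∈⋂ᶠ (F ∘ suc)) z∈rest i })
  (λ z∈F → x∈p∩q⁺ (z∈F zero , from (∈⋂ᶠ (F ∘ suc)) (z∈F ∘ suc)))

∈⋃ᶠ : ∀ {n k} (F : Fin k → Subset n) {z} → z ∈ ⋃ᶠ F ⇔ ∃ (λ i → z ∈ F i)
∈⋃ᶠ {k = zero} F = mk⇔ (λ z∈ → contradiction z∈ ∉⊥) (λ ())
∈⋃ᶠ {k = suc k} F = mk⇔ there-or-here (λ { (zero , z∈) → x∈p∪q⁺ (inj₁ z∈)
                                        ; (suc i , z∈) → x∈p∪q⁺ (inj₂ (from (∈⋃ᶠ (F ∘ suc)) (i , z∈))) })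
  where
  there-or-here : ∀ {z} → z ∈ F zero ∪ ⋃ᶠ (F ∘ suc) → ∃ (λ i → z ∈ F i)
  there-or-here z∈ with x∈p∪q⁻ _ _ z∈
  ... | inj₁ z∈F₀ = zero , z∈F₀
  ... | inj₂ z∈rest = let (i , z∈Fi) = to (∈⋃ᶠ (F ∘ suc)) z∈rest in suc i , z∈Fi

-- The specialisation preorder of a finite topology

-- x ≼ y iff x lies in the closure of {y}; equivalently (open⇒upward,
-- upward⇒open) every open set containing x also contains y.
Spec : ∀ {n} → Topology n → Fin n → Fin n → Set
Spec T x y = InClosure T x ⁅ y ⁆

≈ᵀ-sym : ∀ {n} {T T' : Topology n} → T ≈ᵀ T' → T' ≈ᵀ T
≈ᵀ-sym T≈T' U = sym (T≈T' U)

≈ᵀ⇒spec : ∀ {n} {T T' : Topology n} → T ≈ᵀ T' → ∀ {x y} → Spec T x y → Spec T' x y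
≈ᵀ⇒spec T≈T' x≼y C C-closed = x≼y C (trans (T≈T' _) C-closed)

module _ {n : ℕ} (T : Topology n) where

  spec-refl : ∀ x → Spec T x x
  spec-refl x C _ ⁅x⁆⊆C = ⁅x⁆⊆C x (x∈⁅x⁆ x)

  spec-trans : ∀ {x y z} → Spec T x y → Spec T y z → Spec T x z
  spec-trans x≼y y≼z C C-closed ⁅z⁆⊆C = x≼y C C-closed (⁅⁆⊆ (y≼z C C-closed ⁅z⁆⊆C))

  open⇒∁-closed : ∀ {U} → isOpen T U ≡ true → IsClosed T (∁ U)
  open⇒∁-closed {U} = subst (λ V → isOpen T V ≡ true) (sym (∁-involutive U))

  open⇒upward : ∀ {U} → isOpen T U ≡ true → ∀ {x y} → x ∈ U → Spec T x y → y ∈ U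
  open⇒upward {U} U-open {x} {y} x∈U x≼y with y ∈? U
  ... | yes y∈U = y∈U
  ... | no y∉U = contradiction x∈U (x∈∁p⇒x∉p (x≼y (∁ U) (open⇒∁-closed U-open) (⁅⁆⊆ (x∉p⇒x∈∁p y∉U))))

  Separates : Fin n → Fin n → Subset n → Set
  Separates x y U = isOpen T U ≡ true × x ∈ U × y ∉ U

  separated? : ∀ x y → Dec (∃ (Separates x y))
  separated? x y = anySubset? λ U → (isOpen T U ≟ᵇ true) ×-dec (x ∈? U) ×-dec ¬? (y ∈? U)

  -- If no open set separates x from y then x ≼ y: a closed C ∋ y with
  -- x ∉ C would have the separating open complement ∁ C.
  unseparated⇒spec : ∀ {x y} → ¬ ∃ (Separates x y) → Spec T x y
  unseparated⇒spec {x} {y} unsep C C-closed ⁅y⁆⊆C with x ∈? C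
  ... | yes x∈C = x∈C
  ... | no x∉C = contradiction (∁ C , C-closed , x∉p⇒x∈∁p x∉C , x∈p⇒x∉∁p (⁅y⁆⊆C y (x∈⁅x⁆ y))) unsep

  spec? : ∀ x y → Dec (Spec T x y)
  spec? x y with separated? x y
  ... | yes (U , U-open , x∈U , y∉U) = no λ x≼y → y∉U (open⇒upward U-open x∈U x≼y)
  ... | no unsep = yes (unseparated⇒spec unsep)

  separating-nbhd : ∀ x y → ∃ λ U → isOpen T U ≡ true × x ∈ U × (y ∈ U → Spec T x y)
  separating-nbhd x y with separated? x y
  ... | yes (U , U-open , x∈U , y∉U) = U , U-open , x∈U , λ y∈U → contradiction y∈U y∉U
  ... | no unsep = ⊤ , open-⊤ T , ∈⊤ , λ _ → unseparated⇒spec unsep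

  ⋂ᶠ-open : ∀ {k} (F : Fin k → Subset n) → (∀ i → isOpen T (F i) ≡ true) → isOpen T (⋂ᶠ F) ≡ true
  ⋂ᶠ-open {zero} F F-open = open-⊤ T
  ⋂ᶠ-open {suc k} F F-open = open-∩ T _ _ (F-open zero) (⋂ᶠ-open (F ∘ suc) (F-open ∘ suc))

  ⋃ᶠ-open : ∀ {k} (F : Fin k → Subset n) → (∀ i → isOpen T (F i) ≡ true) → isOpen T (⋃ᶠ F) ≡ true
  ⋃ᶠ-open {zero} F F-open = open-⊥ T
  ⋃ᶠ-open {suc k} F F-open = open-∪ T _ _ (F-open zero) (⋃ᶠ-open (F ∘ suc) (F-open ∘ suc))

  -- The smallest open set containing x; it consists of the points above x.
  nbhd : Fin n → Subset n
  nbhd x = ⋂ᶠ (λ y → proj₁ (separating-nbhd x y))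

  nbhd-open : ∀ x → isOpen T (nbhd x) ≡ true
  nbhd-open x = ⋂ᶠ-open _ λ y → let (_ , V-open , _) = separating-nbhd x y in V-open

  x∈nbhd : ∀ x → x ∈ nbhd x
  x∈nbhd x = from (∈⋂ᶠ _) λ y → let (_ , _ , x∈V , _) = separating-nbhd x y in x∈V

  nbhd-above : ∀ {x y} → y ∈ nbhd x → Spec T x y
  nbhd-above {x} {y} y∈ = let (_ , _ , _ , y∈V⇒x≼y) = separating-nbhd x y in y∈V⇒x≼y (to (∈⋂ᶠ _) y∈ y)

  -- Conversely every upward closed set U is open, being the union of the
  -- minimal neighbourhoods of its points.
  upward⇒open : ∀ U → (∀ {x y} → x ∈ U → Spec T x y → y ∈ U) → isOpen T U ≡ true
  upward⇒open U upward = subst (λ V → isOpen T V ≡ true) (sym U≡⋃pieces)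
                                 (⋃ᶠ-open (proj₁ ∘ piece) λ x → let (_ , V-open , _) = piece x in V-open)
    where
    piece : ∀ x → ∃ λ V → isOpen T V ≡ true × (x ∈ U → x ∈ V) × V ⊆ U
    piece x with x ∈? U
    ... | yes x∈U = nbhd x , nbhd-open x , (λ _ → x∈nbhd x) , λ z∈ → upward x∈U (nbhd-above z∈)
    ... | no x∉U = ∅ , open-⊥ T , (λ x∈U → contradiction x∈U x∉U) , λ z∈∅ → contradiction z∈∅ ∉⊥
    U≡⋃pieces : U ≡ ⋃ᶠ (proj₁ ∘ piece)
    U≡⋃pieces = ⊆-antisym
      (λ {z} z∈U → let (_ , _ , z∈piece , _) = piece z in from (∈⋃ᶠ _) (z , z∈piece z∈U))
      (λ z∈ → let (x , z∈piece) = to (∈⋃ᶠ _) z∈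
                  (_ , _ , _ , piece⊆U) = piece x
              in piece⊆U z∈piece)

module _ {n : ℕ} (L : Fin n → Fin n → Set) (L? : ∀ x y → Dec (L x y)) where

  Upward : Subset n → Set
  Upward U = ∀ x y → x ∈ U → L x y → y ∈ U

  upward? : ∀ U → Dec (Upward U)
  upward? U = all? λ x → all? λ y → (x ∈? U) →-dec L? x y →-dec (y ∈? U)

  Alexandrov : Topology n
  Alexandrov = record
    { isOpen = λ U → does (upward? U)
    ; open-⊥ = dec-true (upward? ∅) λ x y x∈∅ _ → contradiction x∈∅ ∉⊥
    ; open-⊤ = dec-true (upward? ⊤) λ _ _ _ _ → ∈⊤
    ; open-∪ = λ U V U-open V-open → dec-true (upward? (U ∪ V)) (∪-upward (opened U-open) (opened V-open))
    ; open-∩ = λ U V U-open V-open → dec-true (upward? (U ∩ V)) (∩-upward (opened U-open) (opened V-open))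
    }
    where
    opened : ∀ {U} → does (upward? U) ≡ true → Upward U
    opened {U} = to (does⇔ (upward? U))
    ∪-upward : ∀ {U V} → Upward U → Upward V → Upward (U ∪ V)
    ∪-upward {U} {V} U↑ V↑ x y x∈ xLy with x∈p∪q⁻ U V x∈
    ... | inj₁ x∈U = x∈p∪q⁺ (inj₁ (U↑ x y x∈U xLy))
    ... | inj₂ x∈V = x∈p∪q⁺ (inj₂ (V↑ x y x∈V xLy))
    ∩-upward : ∀ {U V} → Upward U → Upward V → Upward (U ∩ V)
    ∩-upward {U} {V} U↑ V↑ x y x∈ xLy =
      let (x∈U , x∈V) = x∈p∩q⁻ U V x∈ in x∈p∩q⁺ (U↑ x y x∈U xLy , V↑ x y x∈V xLy)

  alexandrov-open : ∀ U → isOpen Alexandrov U ≡ true ⇔ Upward U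
  alexandrov-open U = does⇔ (upward? U)

  -- L is contained in the specialisation preorder of its Alexandrov topology,
  -- with equality when L is a preorder: then the complement of the up-set
  -- of x is a closed set containing every y with x ̸L y.
  spec-alexandrov : (∀ x → L x x) → (∀ {x y z} → L x y → L y z → L x z) →
                    ∀ x y → Spec Alexandrov x y ⇔ L x y
  spec-alexandrov L-refl L-trans x y = mk⇔ spec⇒L L⇒spec
    where
    L⇒spec : L x y → Spec Alexandrov x y
    L⇒spec xLy C C-closed ⁅y⁆⊆C with x ∈? C
    ... | yes x∈C = x∈C
    ... | no x∉C = contradiction (⁅y⁆⊆C y (x∈⁅x⁆ y))
                     (x∈∁p⇒x∉p (to (alexandrov-open (∁ C)) C-closed x y (x∉p⇒x∈∁p x∉C) xLy))
    up : Subset n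
    up = tabulate (does ∘ L? x)
    up-open : isOpen Alexandrov up ≡ true
    up-open = from (alexandrov-open up) λ a b a∈ aLb → from (∈-filter (L? x)) (L-trans (to (∈-filter (L? x)) a∈) aLb)
    spec⇒L : Spec Alexandrov x y → L x y
    spec⇒L x≼y with L? x y
    ... | yes xLy = xLy
    ... | no ¬xLy = contradiction (from (∈-filter (L? x)) (L-refl x)) (x∈∁p⇒x∉p x∈∁up)
      where
      x∈∁up : x ∈ ∁ up
      x∈∁up = x≼y (∁ up) (open⇒∁-closed Alexandrov up-open) (⁅⁆⊆ (x∉p⇒x∈∁p (¬xLy ∘ to (∈-filter (L? x)))))

≈alexandrov : ∀ {n} (T : Topology n) (L : Fin n → Fin n → Set) (L? : ∀ x y → Dec (L x y)) →
              (∀ x y → Spec T x y ⇔ L x y) → T ≈ᵀ Alexandrov L L?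
≈alexandrov T L L? spec⇔L U = ⇔→≡ {z = true} (mk⇔
  (λ U-open → from (alexandrov-open L L? U) λ x y x∈U xLy → open⇒upward T U-open x∈U (from (spec⇔L x y) xLy))
  (λ U-open → upward⇒open T U λ {x} {y} x∈U x≼y → to (alexandrov-open L L? U) U-open x y x∈U (to (spec⇔L x y) x≼y)))

alexandrov-graph : ∀ {n} (L : Fin n → Fin n → Set) (L? : ∀ x y → Dec (L x y)) →
                   (∀ x → L x x) → (∀ {x y z} → L x y → L y z → L x z) →
                   (G : Graph n) → (∀ x y → G x y ⇔ (x ≢ y × (L x y ⊎ L y x))) →
                   HasUnderlyingGraph (Alexandrov L L?) G
alexandrov-graph L L? L-refl L-trans G G⇔comparable x y = mk⇔
  (λ (x≢y , x≼y⊎y≼x) → from (G⇔comparable x y) (x≢y , ⊎-map (to (spec x y)) (to (spec y x)) x≼y⊎y≼x))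
  (λ Gxy → let (x≢y , comparable) = to (G⇔comparable x y) Gxy in
           x≢y , ⊎-map (from (spec x y)) (from (spec y x)) comparable)
  where
  spec = spec-alexandrov L L? L-refl L-trans

homeo-refl : ∀ {n} (T : Topology n) → Homeomorphic T T
homeo-refl T = Perm.id , λ U → cong (isOpen T) (sym (tabulate∘lookup U))

≈-homeo : ∀ {n} {T T₁ T₂ : Topology n} → T ≈ᵀ T₁ → Homeomorphic T₁ T₂ → Homeomorphic T T₂
≈-homeo T≈T₁ (σ , σ-homeo) = σ , λ U → trans (σ-homeo U) (sym (T≈T₁ _))

alexandrov-homeo : ∀ {n} (L : Fin n → Fin n → Set) (L? : ∀ x y → Dec (L x y))
                   (L' : Fin n → Fin n → Set) (L'? : ∀ x y → Dec (L' x y)) (σ : Permutation′ n) →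
                   (∀ x y → L x y ⇔ L' (σ ⟨$⟩ʳ x) (σ ⟨$⟩ʳ y)) →
                   Homeomorphic (Alexandrov L L?) (Alexandrov L' L'?)
alexandrov-homeo L L? L' L'? σ L⇔L' = σ , λ U → ⇔→≡ {z = true} (mk⇔ (pull U) (push U))
  where
  σ⁻¹ = σ ⟨$⟩ˡ_
  pull : ∀ U → isOpen (Alexandrov L' L'?) U ≡ true → isOpen (Alexandrov L L?) (preimage σ U) ≡ true
  pull U U-open = from (alexandrov-open L L? _) λ x y x∈ xLy →
    from (∈-preimage σ U) (to (alexandrov-open L' L'? U) U-open _ _ (to (∈-preimage σ U) x∈) (to (L⇔L' x y) xLy))
  push : ∀ U → isOpen (Alexandrov L L?) (preimage σ U) ≡ true → isOpen (Alexandrov L' L'?) U ≡ true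
  push U pre-open = from (alexandrov-open L' L'? U) λ a b a∈U aL'b →
    subst (_∈ U) (inverseʳ σ) (to (∈-preimage σ U)
      (to (alexandrov-open L L? _) pre-open (σ⁻¹ a) (σ⁻¹ b)
        (from (∈-preimage σ U) (subst (_∈ U) (sym (inverseʳ σ)) a∈U))
        (from (L⇔L' (σ⁻¹ a) (σ⁻¹ b)) (subst₂ L' (sym (inverseʳ σ)) (sym (inverseʳ σ)) aL'b))))

preimage-⁅⁆ : ∀ {n} (σ : Permutation′ n) a → preimage σ ⁅ a ⁆ ≡ ⁅ σ ⟨$⟩ˡ a ⁆
preimage-⁅⁆ σ a = ⊆-antisym
  (λ z∈ → from x∈⁅y⁆⇔x≡y (trans (sym (inverseˡ σ)) (cong (σ ⟨$⟩ˡ_) (to x∈⁅y⁆⇔x≡y (to (∈-preimage σ _) z∈)))))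
  (λ z∈ → from (∈-preimage σ _) (from x∈⁅y⁆⇔x≡y (trans (cong (σ ⟨$⟩ʳ_) (to x∈⁅y⁆⇔x≡y z∈)) (inverseʳ σ))))

preimage-∁ : ∀ {n} (σ : Permutation′ n) U → preimage σ (∁ U) ≡ ∁ (preimage σ U)
preimage-∁ σ U = ⊆-antisym
  (λ z∈ → x∉p⇒x∈∁p (x∈∁p⇒x∉p (to (∈-preimage σ _) z∈) ∘ to (∈-preimage σ U)))
  (λ z∈ → from (∈-preimage σ _) (x∉p⇒x∈∁p (x∈∁p⇒x∉p z∈ ∘ from (∈-preimage σ U))))

module _ {n : ℕ} (F : Fin n → Subset n) (F-natural : ∀ σ a → preimage σ (F a) ≡ F (σ ⟨$⟩ˡ a)) where

  HasOpen : Topology n → Set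
  HasOpen T = ∃ λ x → isOpen T (F x) ≡ true

  hasOpen? : ∀ T → Dec (HasOpen T)
  hasOpen? T = any? λ x → isOpen T (F x) ≟ᵇ true

  homeo-hasOpen : ∀ {T T'} → Homeomorphic T T' → HasOpen T ⇔ HasOpen T'
  homeo-hasOpen {T} {T'} (σ , σ-homeo) = mk⇔
    (λ (x , Fx-open) → σ ⟨$⟩ʳ x , (begin
        isOpen T' (F (σ ⟨$⟩ʳ x))                ≡⟨ σ-homeo _ ⟩
        isOpen T (preimage σ (F (σ ⟨$⟩ʳ x)))     ≡⟨ cong (isOpen T) (F-natural σ _) ⟩
        isOpen T (F (σ ⟨$⟩ˡ (σ ⟨$⟩ʳ x)))         ≡⟨ cong (isOpen T ∘ F) (inverseˡ σ) ⟩
        isOpen T (F x)                          ≡⟨ Fx-open ⟩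
        true                                    ∎))
    (λ (a , Fa-open) → σ ⟨$⟩ˡ a , (begin
        isOpen T (F (σ ⟨$⟩ˡ a))                 ≡⟨ cong (isOpen T) (F-natural σ a) ⟨
        isOpen T (preimage σ (F a))             ≡⟨ σ-homeo _ ⟨
        isOpen T' (F a)                         ≡⟨ Fa-open ⟩
        true                                    ∎))
    where open ≡-Reasoning

preimage-∁⁅⁆ : ∀ {n} (σ : Permutation′ n) a → preimage σ (∁ ⁅ a ⁆) ≡ ∁ ⁅ σ ⟨$⟩ˡ a ⁆
preimage-∁⁅⁆ σ a = trans (preimage-∁ σ ⁅ a ⁆) (cong ∁ (preimage-⁅⁆ σ a))

-- Whether some singleton, resp. some co-singleton, is open: together these
-- distinguish the four homeomorphism types of total preorders on three points.
signature : ∀ {n} → Topology n → Bool × Bool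
signature T = does (hasOpen? ⁅_⁆ preimage-⁅⁆ T) , does (hasOpen? (∁ ∘ ⁅_⁆) preimage-∁⁅⁆ T)

homeo-signature : ∀ {n} {T T' : Topology n} → Homeomorphic T T' → signature T ≡ signature T'
homeo-signature {T = T} {T'} h = cong₂ _,_ (invariant ⁅_⁆ preimage-⁅⁆) (invariant (∁ ∘ ⁅_⁆) preimage-∁⁅⁆)
  where
  invariant : ∀ F F-natural → does (hasOpen? F F-natural T) ≡ does (hasOpen? F F-natural T')
  invariant F F-natural = does-⇔ (homeo-hasOpen F F-natural {T} {T'} h) (hasOpen? F F-natural T) (hasOpen? F F-natural T')

count-none : ∀ {A : Set} {P : A → Set} {_~_ : A → A → Set} → (∀ a → ¬ P a) → CountUpTo A P _~_ 0
count-none noP = (λ ()) , (λ ()) , (λ ()) , λ a Pa → contradiction Pa (noP a)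

count-one : ∀ {A : Set} {P : A → Set} {_~_ : A → A → Set} {a} →
            P a → (∀ b → P b → b ~ a) → CountUpTo A P _~_ 1
count-one {a = a} Pa all~a = (λ _ → a) , (λ _ → Pa) , (λ { zero zero _ → refl }) , λ b Pb → zero , all~a b Pb

count-two : ∀ {A : Set} {P : A → Set} {_~_ : A → A → Set} {a b} →
            P a → P b → ¬ a ~ b → ¬ b ~ a → (∀ c → P c → c ~ a ⊎ c ~ b) → CountUpTo A P _~_ 2
count-two {A} {P} {_~_} {a} {b} Pa Pb a≁b b≁a cover = pick , P-pick , pick-injective , covered
  where
  pick : Fin 2 → A
  pick zero = a
  pick (suc zero) = b
  P-pick : ∀ i → P (pick i)
  P-pick zero = Pa
  P-pick (suc zero) = Pb
  pick-injective : ∀ i j → pick i ~ pick j → i ≡ j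
  pick-injective zero zero _ = refl
  pick-injective zero (suc zero) a~b = contradiction a~b a≁b
  pick-injective (suc zero) zero b~a = contradiction b~a b≁a
  pick-injective (suc zero) (suc zero) _ = refl
  covered : ∀ c → P c → ∃ λ i → c ~ pick i
  covered c Pc with cover c Pc
  ... | inj₁ c~a = zero , c~a
  ... | inj₂ c~b = suc zero , c~b

RankLe : ∀ {n} → (Fin n → ℕ) → Fin n → Fin n → Set
RankLe r x y = r x ≤ r y

rankLe? : ∀ {n} (r : Fin n → ℕ) x y → Dec (RankLe r x y)
rankLe? r x y = r x ≤? r y

RankTop : ∀ {n} → (Fin n → ℕ) → Topology n
RankTop r = Alexandrov (RankLe r) (rankLe? r)

spec-rankTop : ∀ {n} (r : Fin n → ℕ) x y → Spec (RankTop r) x y ⇔ r x ≤ r y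
spec-rankTop r = spec-alexandrov (RankLe r) (rankLe? r) (λ _ → ≤-refl) ≤-trans

SameOrder : ∀ {n} → (Fin n → ℕ) → (Fin n → ℕ) → Set
SameOrder r s = ∀ x y → (r x ≤ᵇ r y) ≡ (s x ≤ᵇ s y)

sameOrder? : ∀ {n} (r s : Fin n → ℕ) → Dec (SameOrder r s)
sameOrder? r s = all? λ x → all? λ y → (r x ≤ᵇ r y) ≟ᵇ (s x ≤ᵇ s y)

sameOrder⇒⇔ : ∀ {n} {r s : Fin n → ℕ} → SameOrder r s → ∀ x y → r x ≤ r y ⇔ s x ≤ s y
sameOrder⇒⇔ {r = r} {s} same x y = mk⇔
  (λ le → to (does⇔ (s x ≤? s y)) (trans (sym (same x y)) (from (does⇔ (r x ≤? r y)) le)))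
  (λ le → to (does⇔ (r x ≤? r y)) (trans (same x y) (from (does⇔ (s x ≤? s y)) le)))

sameOrder-≗ : ∀ {n} {r r' s : Fin n → ℕ} → r ≗ r' → SameOrder r s → SameOrder r' s
sameOrder-≗ {r = r} r≗r' same x y = trans (cong₂ _≤ᵇ_ (sym (r≗r' x)) (sym (r≗r' y))) (same x y)

rankTop-≈ : ∀ {n} {r s : Fin n → ℕ} → SameOrder r s → RankTop r ≈ᵀ RankTop s
rankTop-≈ {r = r} {s} same = ≈alexandrov (RankTop r) (RankLe s) (rankLe? s) λ x y →
  mk⇔ (to (sameOrder⇒⇔ same x y) ∘ to (spec-rankTop r x y))
      (from (spec-rankTop r x y) ∘ from (sameOrder⇒⇔ same x y))

≈⇒sameOrder : ∀ {n} {r s : Fin n → ℕ} → RankTop r ≈ᵀ RankTop s → SameOrder r s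
≈⇒sameOrder {r = r} {s} r≈s x y = does-⇔ (mk⇔ (transport r≈s) (transport s≈r)) (r x ≤? r y) (s x ≤? s y)
  where
  s≈r : RankTop s ≈ᵀ RankTop r
  s≈r = ≈ᵀ-sym {T = RankTop r} {RankTop s} r≈s
  transport : ∀ {r′ s′} → RankTop r′ ≈ᵀ RankTop s′ → r′ x ≤ r′ y → s′ x ≤ s′ y
  transport {r′} {s′} r′≈s′ = to (spec-rankTop s′ x y) ∘ ≈ᵀ⇒spec {T = RankTop r′} {RankTop s′} r′≈s′ ∘ from (spec-rankTop r′ x y)

rankTop-homeo : ∀ {n} {r s : Fin n → ℕ} (σ : Permutation′ n) →
                SameOrder r (s ∘ (σ ⟨$⟩ʳ_)) → Homeomorphic (RankTop r) (RankTop s)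
rankTop-homeo {r = r} {s} σ same = alexandrov-homeo (RankLe r) (rankLe? r) (RankLe s) (rankLe? s) σ (sameOrder⇒⇔ same)

down : ∀ {n} → Topology n → Fin n → Subset n
down T x = tabulate λ z → does (spec? T z x)

∈-down : ∀ {n} (T : Topology n) {x z} → z ∈ down T x ⇔ Spec T z x
∈-down T {x} = ∈-filter (λ z → spec? T z x)

-- If the specialisation preorder is total, x ≼ y iff ↓x has at most as many
-- points as ↓y: x ≼ y gives ↓x ⊆ ↓y, while y ≺ x gives ↓y ⊂ ↓x strictly.
total⇒rankTop : ∀ {n} (T : Topology n) → (∀ x y → Spec T x y ⊎ Spec T y x) →
                T ≈ᵀ RankTop (λ x → ∣ down T x ∣)
total⇒rankTop T total = ≈alexandrov T (RankLe (∣_∣ ∘ down T)) (rankLe? (∣_∣ ∘ down T)) λ x y →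
  mk⇔ (p⊆q⇒∣p∣≤∣q∣ ∘ down-mono) (size⇒spec x y)
  where
  down-mono : ∀ {x y} → Spec T x y → down T x ⊆ down T y
  down-mono x≼y z∈ = from (∈-down T) (spec-trans T (to (∈-down T) z∈) x≼y)
  size⇒spec : ∀ x y → ∣ down T x ∣ ≤ ∣ down T y ∣ → Spec T x y
  size⇒spec x y size≤ with spec? T x y | total x y
  ... | yes x≼y | _ = x≼y
  ... | no x⋠y | inj₁ x≼y = contradiction x≼y x⋠y
  ... | no x⋠y | inj₂ y≼x = contradiction size≤ (<⇒≱ (p⊂q⇒∣p∣<∣q∣ down-y⊂down-x))
    where
    down-y⊂down-x : down T y ⊂ down T x
    down-y⊂down-x = down-mono y≼x , x , from (∈-down T) (spec-refl T x) , x⋠y ∘ to (∈-down T)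

Follows : ℕ → ℕ → ℕ → Set
Follows N a b = suc a ≡ b ⊎ (b ≡ 0 × suc a ≡ N)

cycle⇔follows : ∀ {N} {x y : Fin N} →
                Cycle N x y ⇔ (Follows N (toℕ x) (toℕ y) ⊎ Follows N (toℕ y) (toℕ x))
cycle⇔follows = mk⇔
  (λ { (inj₁ e) → inj₁ (inj₁ (+1 e)) ; (inj₂ (inj₁ e)) → inj₂ (inj₁ (+1 e))
     ; (inj₂ (inj₂ (inj₁ (x≡0 , e)))) → inj₂ (inj₂ (x≡0 , +1 e))
     ; (inj₂ (inj₂ (inj₂ (y≡0 , e)))) → inj₁ (inj₂ (y≡0 , +1 e)) })
  (λ { (inj₁ (inj₁ e)) → inj₁ (suc⁻ e) ; (inj₂ (inj₁ e)) → inj₂ (inj₁ (suc⁻ e))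
     ; (inj₂ (inj₂ (x≡0 , e))) → inj₂ (inj₂ (inj₁ (x≡0 , suc⁻ e)))
     ; (inj₁ (inj₂ (y≡0 , e))) → inj₂ (inj₂ (inj₂ (y≡0 , suc⁻ e))) })
  where
  +1 : ∀ {a b} → a + 1 ≡ b → suc a ≡ b
  +1 {a} = trans (+-comm 1 a)
  suc⁻ : ∀ {a b} → suc a ≡ b → a + 1 ≡ b
  suc⁻ {a} = trans (+-comm a 1)

cycle-sym : ∀ {N} {x y : Fin N} → Cycle N x y → Cycle N y x
cycle-sym = from cycle⇔follows ∘ ⊎-swap ∘ to cycle⇔follows

cycle-irrefl : ∀ {N} → N ≢ 1 → ∀ {x : Fin N} → ¬ Cycle N x x
cycle-irrefl N≢1 c with to cycle⇔follows c
... | inj₁ (inj₁ e) = 1+n≢n e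
... | inj₂ (inj₁ e) = 1+n≢n e
... | inj₁ (inj₂ (x≡0 , e)) = N≢1 (trans (sym e) (cong suc x≡0))
... | inj₂ (inj₂ (x≡0 , e)) = N≢1 (trans (sym e) (cong suc x≡0))

cycle? : ∀ {N} (x y : Fin N) → Dec (Cycle N x y)
cycle? {N} x y = (toℕ x + 1 ≟ℕ toℕ y) ⊎-dec (toℕ y + 1 ≟ℕ toℕ x)
           ⊎-dec ((toℕ x ≟ℕ 0) ×-dec (toℕ y + 1 ≟ℕ N)) ⊎-dec ((toℕ y ≟ℕ 0) ×-dec (toℕ x + 1 ≟ℕ N))

follows-injective : ∀ {N a b c} → Follows N a c → Follows N b c → a ≡ b
follows-injective (inj₁ refl) (inj₁ e) = sym (suc-injective e)
follows-injective (inj₁ refl) (inj₂ (() , _))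
follows-injective (inj₂ (refl , _)) (inj₁ ())
follows-injective (inj₂ (_ , e)) (inj₂ (_ , e')) = suc-injective (trans e (sym e'))

follows-functional : ∀ {N a b c} → b < N → c < N → Follows N a b → Follows N a c → b ≡ c
follows-functional _ _ (inj₁ refl) (inj₁ refl) = refl
follows-functional b<N _ (inj₁ refl) (inj₂ (_ , refl)) = contradiction b<N (<-irrefl refl)
follows-functional _ c<N (inj₂ (_ , refl)) (inj₁ refl) = contradiction c<N (<-irrefl refl)
follows-functional _ _ (inj₂ (refl , _)) (inj₂ (refl , _)) = refl

two-steps : ∀ {N a b c} → Follows N a b → Follows N b c →
            a ≡ c ⊎ Follows N a c ⊎ Follows N c a → N ≤ 3
two-steps (inj₁ refl) (inj₁ refl) (inj₁ ())
two-steps (inj₁ refl) (inj₁ refl) (inj₂ (inj₁ (inj₁ ())))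
two-steps (inj₁ refl) (inj₁ refl) (inj₂ (inj₁ (inj₂ (() , _))))
two-steps (inj₁ refl) (inj₁ refl) (inj₂ (inj₂ (inj₁ ())))
two-steps (inj₁ refl) (inj₁ refl) (inj₂ (inj₂ (inj₂ (refl , refl)))) = ≤-refl
two-steps (inj₁ refl) (inj₂ (refl , refl)) (inj₁ refl) = s≤s (s≤s z≤n)
two-steps (inj₁ refl) (inj₂ (refl , refl)) (inj₂ (inj₁ (inj₁ ())))
two-steps (inj₁ refl) (inj₂ (refl , refl)) (inj₂ (inj₁ (inj₂ (_ , ()))))
two-steps (inj₁ refl) (inj₂ (refl , refl)) (inj₂ (inj₂ (inj₁ refl))) = ≤-refl
two-steps (inj₁ refl) (inj₂ (refl , refl)) (inj₂ (inj₂ (inj₂ (refl , ()))))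
two-steps (inj₂ (refl , refl)) (inj₁ refl) (inj₁ refl) = s≤s (s≤s z≤n)
two-steps (inj₂ (refl , refl)) (inj₁ refl) (inj₂ (inj₁ (inj₁ refl))) = s≤s z≤n
two-steps (inj₂ (refl , refl)) (inj₁ refl) (inj₂ (inj₁ (inj₂ (() , _))))
two-steps (inj₂ (refl , refl)) (inj₁ refl) (inj₂ (inj₂ (inj₁ refl))) = ≤-refl
two-steps (inj₂ (refl , refl)) (inj₁ refl) (inj₂ (inj₂ (inj₂ (refl , ()))))
two-steps (inj₂ (refl , refl)) (inj₂ (refl , refl)) _ = s≤s z≤n

module _ {m : ℕ} where

  next : Fin (suc m) → Fin (suc m)
  next x with suc (toℕ x) <? suc m
  ... | yes x+1<N = fromℕ< x+1<N
  ... | no _ = zero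

  next-follows : ∀ x → Follows (suc m) (toℕ x) (toℕ (next x))
  next-follows x with suc (toℕ x) <? suc m
  ... | yes x+1<N = inj₁ (sym (toℕ-fromℕ< x+1<N))
  ... | no x+1≮N = inj₂ (refl , ≤∧≮⇒≡ (toℕ<n x) x+1≮N)

  follows⇒next : ∀ {x y} → Follows (suc m) (toℕ x) (toℕ y) → y ≡ next x
  follows⇒next {x} {y} x→y = toℕ-injective (follows-functional (toℕ<n y) (toℕ<n (next x)) x→y (next-follows x))

  prev : Fin (suc m) → Fin (suc m)
  prev zero = fromℕ m
  prev (suc i) = inject₁ i

  prev-follows : ∀ y → Follows (suc m) (toℕ (prev y)) (toℕ y)
  prev-follows zero = inj₂ (refl , cong suc (toℕ-fromℕ m))
  prev-follows (suc i) = inj₁ (cong suc (toℕ-inject₁ i))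

  next-prev : ∀ y → next (prev y) ≡ y
  next-prev y = sym (follows⇒next (prev-follows y))

  prev-next : ∀ x → prev (next x) ≡ x
  prev-next x = toℕ-injective (follows-injective (prev-follows (next x)) (next-follows x))

  next-injective : ∀ {x y} → next x ≡ next y → x ≡ y
  next-injective {x} {y} e = trans (sym (prev-next x)) (trans (cong prev e) (prev-next y))

  rotation : Permutation′ (suc m)
  rotation = permutation next prev next-prev prev-next

  cycle-next : ∀ x → Cycle (suc m) x (next x)
  cycle-next x = from cycle⇔follows (inj₁ (next-follows x))

  cycle⇒next : ∀ {x y} → Cycle (suc m) x y → y ≡ next x ⊎ x ≡ next y
  cycle⇒next c = ⊎-map follows⇒next follows⇒next (to cycle⇔follows c)

  cycle-rotate : ∀ {x y} → Cycle (suc m) x y ⇔ Cycle (suc m) (next x) (next y)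
  cycle-rotate {x} {y} = mk⇔ forward backward
    where
    forward : Cycle (suc m) x y → Cycle (suc m) (next x) (next y)
    forward c with cycle⇒next c
    ... | inj₁ refl = cycle-next (next x)
    ... | inj₂ refl = cycle-sym (cycle-next (next y))
    backward : Cycle (suc m) (next x) (next y) → Cycle (suc m) x y
    backward c with cycle⇒next c
    ... | inj₁ e = subst (Cycle (suc m) x) (next-injective (sym e)) (cycle-next x)
    ... | inj₂ e = subst (λ z → Cycle (suc m) z y) (next-injective (sym e)) (cycle-sym (cycle-next y))

flips : ℕ → Bool → Bool
flips zero b = b
flips (suc k) b = not (flips k b)

even : ℕ → Bool
even k = flips k true

flips-not : ∀ k b → flips k (not b) ≡ not (flips k b)
flips-not zero b = refl
flips-not (suc k) b = cong not (flips-not k b)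

flips-even : ∀ k → even k ≡ true → ∀ b → flips k b ≡ b
flips-even k even-k true = even-k
flips-even k even-k false = trans (flips-not k true) (cong not even-k)

flips-odd : ∀ k → even k ≡ false → ∀ b → flips k b ≡ not b
flips-odd k odd-k true = odd-k
flips-odd k odd-k false = trans (flips-not k true) (cong not odd-k)

module _ {m : ℕ} where

  flips-next : even (suc m) ≡ true → ∀ b (x : Fin (suc m)) → flips (toℕ (next x)) b ≡ not (flips (toℕ x) b)
  flips-next even-N b x with next-follows x
  ... | inj₁ e = sym (cong (λ k → flips k b) e)
  ... | inj₂ (next≡0 , x+1≡N) = begin
    flips (toℕ (next x)) b   ≡⟨ cong (λ k → flips k b) next≡0 ⟩
    b                        ≡⟨ flips-even (suc m) even-N b ⟨
    flips (suc m) b          ≡⟨ cong (λ k → flips k b) x+1≡N ⟨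
    not (flips (toℕ x) b)    ∎
    where open ≡-Reasoning

  flips-adjacent : even (suc m) ≡ true → ∀ b {x y : Fin (suc m)} → Cycle (suc m) x y →
                   flips (toℕ y) b ≡ not (flips (toℕ x) b)
  flips-adjacent even-N b c with cycle⇒next c
  ... | inj₁ refl = flips-next even-N b _
  ... | inj₂ refl = trans (sym (not-involutive _)) (cong not (sym (flips-next even-N b _)))

  walk : ℕ → Fin (suc m)
  walk zero = zero
  walk (suc k) = next (walk k)

  toℕ-walk : ∀ {k} → k < suc m → toℕ (walk k) ≡ k
  toℕ-walk {zero} _ = refl
  toℕ-walk {suc k} k+1<N with next-follows (walk k) | toℕ-walk {k} (<-trans (n<1+n k) k+1<N)
  ... | inj₁ e | ih = trans (sym e) (cong suc ih)
  ... | inj₂ (_ , x+1≡N) | ih = contradiction (trans (cong suc (sym ih)) x+1≡N) (<⇒≢ k+1<N)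

  walk-toℕ : ∀ x → walk (toℕ x) ≡ x
  walk-toℕ x = toℕ-injective (toℕ-walk (toℕ<n x))

  walk-around : walk (suc m) ≡ zero
  walk-around = sym (follows⇒next {x = walk m} (inj₂ (refl , cong suc (toℕ-walk ≤-refl))))

  -- A labelling which changes along every edge is determined by its value
  -- at 0; in particular (walking once around) it exists only on even cycles.
  Alternating : (Fin (suc m) → Bool) → Set
  Alternating u = ∀ x → u (next x) ≡ not (u x)

  alternating-walk : ∀ {u} → Alternating u → ∀ k → u (walk k) ≡ flips k (u zero)
  alternating-walk alt zero = refl
  alternating-walk alt (suc k) = trans (alt (walk k)) (cong not (alternating-walk alt k))

  alternating-labels : ∀ {u} → Alternating u → ∀ x → u x ≡ flips (toℕ x) (u zero)
  alternating-labels {u} alt x = trans (cong u (sym (walk-toℕ x))) (alternating-walk alt (toℕ x))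

  alternating⇒even : ∀ {u} → Alternating u → even (suc m) ≡ true
  alternating⇒even {u} alt with even (suc m) in parity
  ... | true = refl
  ... | false = contradiction u₀≡¬u₀ (not-¬ refl)
    where
    u₀≡¬u₀ : u zero ≡ not (u zero)
    u₀≡¬u₀ = begin
      u zero                      ≡⟨ cong u walk-around ⟨
      u (walk (suc m))            ≡⟨ alternating-walk alt (suc m) ⟩
      flips (suc m) (u zero)      ≡⟨ flips-odd (suc m) parity (u zero) ⟩
      not (u zero)                ∎
      where open ≡-Reasoning

-- The triangle C₃: topologies with underlying graph C₃ are the total
-- preorders on three points, i.e. rank topologies.

triangle-complete : ∀ (x y : Fin 3) → Cycle 3 x y ⇔ x ≢ y
triangle-complete x y = mk⇔ (λ c x≡y → cycle-irrefl (λ ()) (subst (Cycle 3 x) (sym x≡y) c)) (adjacent x y)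
  where
  adjacent : ∀ (x y : Fin 3) → x ≢ y → Cycle 3 x y
  adjacent = toWitness {a? = all? λ x → all? λ y → ¬? (x ≟ y) →-dec cycle? x y} tt

rankTop-triangle : ∀ (r : Fin 3 → ℕ) → HasUnderlyingGraph (RankTop r) (Cycle 3)
rankTop-triangle r = alexandrov-graph (RankLe r) (rankLe? r) (λ _ → ≤-refl) ≤-trans (Cycle 3) λ x y →
  mk⇔ (λ c → to (triangle-complete x y) c , ≤-total (r x) (r y)) (from (triangle-complete x y) ∘ proj₁)

-- Distinct points of C₃ are adjacent, so the specialisation preorder is total.
triangle⇒rankTop : ∀ T → HasUnderlyingGraph T (Cycle 3) → T ≈ᵀ RankTop (∣_∣ ∘ down T)
triangle⇒rankTop T graph = total⇒rankTop T total
  where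
  total : ∀ x y → Spec T x y ⊎ Spec T y x
  total x y with x ≟ y
  ... | yes refl = inj₁ (spec-refl T x)
  ... | no x≢y = proj₂ (from (graph x y) (from (triangle-complete x y) x≢y))

-- The 13 total preorders on three points, as rank functions.
ranks : Vec (Vec ℕ 3) 13
ranks = (0 ∷ 0 ∷ 0 ∷ [])
      ∷ (0 ∷ 0 ∷ 1 ∷ []) ∷ (0 ∷ 1 ∷ 0 ∷ []) ∷ (1 ∷ 0 ∷ 0 ∷ [])
      ∷ (0 ∷ 1 ∷ 1 ∷ []) ∷ (1 ∷ 0 ∷ 1 ∷ []) ∷ (1 ∷ 1 ∷ 0 ∷ [])
      ∷ (0 ∷ 1 ∷ 2 ∷ []) ∷ (0 ∷ 2 ∷ 1 ∷ []) ∷ (1 ∷ 0 ∷ 2 ∷ [])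
      ∷ (1 ∷ 2 ∷ 0 ∷ []) ∷ (2 ∷ 0 ∷ 1 ∷ []) ∷ (2 ∷ 1 ∷ 0 ∷ []) ∷ []

rank : Fin 13 → Fin 3 → ℕ
rank i = lookup (lookup ranks i)

-- One representative for each homeomorphism type: indiscrete, a point
-- above a pair, a pair above a point, a chain.
representatives : Vec (Vec ℕ 3) 4
representatives = (0 ∷ 0 ∷ 0 ∷ []) ∷ (0 ∷ 0 ∷ 1 ∷ []) ∷ (0 ∷ 1 ∷ 1 ∷ []) ∷ (0 ∷ 1 ∷ 2 ∷ []) ∷ []

representative : Fin 4 → Fin 3 → ℕ
representative j = lookup (lookup representatives j)

permutations : Vec (Permutation′ 3) 6
permutations = Perm.id ∷ transpose (# 0) (# 1) ∷ transpose (# 0) (# 2) ∷ transpose (# 1) (# 2)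
             ∷ transpose (# 0) (# 1) ∘ₚ transpose (# 1) (# 2)
             ∷ transpose (# 1) (# 2) ∘ₚ transpose (# 0) (# 1) ∷ []

-- Exhaustive checks, decided by evaluation; rank functions Fin 3 → Fin 4 are
-- coded by Fin (4 ^ 3).  They are kept abstract so that uses of them never
-- unfold the decision procedures.
abstract
  ranks-cover : ∀ c → ∃ λ i → SameOrder (toℕ ∘ finToFun {4} {3} c) (rank i)
  ranks-cover = toWitness {a? = all? λ c → any? λ i → sameOrder? (toℕ ∘ finToFun c) (rank i)} tt

  ranks-distinct : ∀ i j → SameOrder (rank i) (rank j) → i ≡ j
  ranks-distinct = toWitness {a? = all? λ i → all? λ j → sameOrder? (rank i) (rank j) →-dec i ≟ j} tt

  representatives-cover : ∀ c → ∃ λ j → ∃ λ p →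
    SameOrder (toℕ ∘ finToFun {4} {3} c) (representative j ∘ (lookup permutations p ⟨$⟩ʳ_))
  representatives-cover = toWitness {a? = all? λ c → any? λ j → any? λ p →
    sameOrder? (toℕ ∘ finToFun c) (representative j ∘ (lookup permutations p ⟨$⟩ʳ_))} tt

  representatives-distinct : ∀ i j → signature (RankTop (representative i)) ≡ signature (RankTop (representative j)) → i ≡ j
  representatives-distinct = toWitness {a? = all? λ i → all? λ j →
    ×-≡-dec _≟ᵇ_ _≟ᵇ_ (signature (RankTop (representative i))) (signature (RankTop (representative j))) →-dec i ≟ j} tt

bounded-code : ∀ (r : Fin 3 → ℕ) → (∀ x → r x ≤ 3) → ∃ λ c → toℕ ∘ finToFun {4} {3} c ≗ r
bounded-code r r≤3 = funToFin r′ , λ x → trans (cong toℕ (finToFun-funToFin r′ x)) (toℕ-fromℕ< _)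
  where
  r′ : Fin 3 → Fin 4
  r′ x = fromℕ< (s≤s (r≤3 x))

size-code : ∀ (T : Topology 3) → ∃ λ c → toℕ ∘ finToFun {4} {3} c ≗ ∣_∣ ∘ down T
size-code T = bounded-code (∣_∣ ∘ down T) (∣p∣≤n ∘ down T)

triangle-τ : TauBar (Cycle 3) 13
triangle-τ = RankTop ∘ rank , rankTop-triangle ∘ rank
           , (λ i j i≈j → ranks-distinct i j (≈⇒sameOrder {r = rank i} {rank j} i≈j)) , cover
  where
  cover : ∀ T → HasUnderlyingGraph T (Cycle 3) → ∃ λ i → T ≈ᵀ RankTop (rank i)
  cover T graph =
    let (c , c≗size) = size-code T
        (i , same) = ranks-cover c
    in i , λ U → trans (triangle⇒rankTop T graph U)
                       (rankTop-≈ {r = ∣_∣ ∘ down T} {rank i} (sameOrder-≗ {s = rank i} c≗size same) U)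

triangle-ħ : HBar (Cycle 3) 4
triangle-ħ = RankTop ∘ representative , rankTop-triangle ∘ representative
           , (λ i j i≅j → representatives-distinct i j
                (homeo-signature {T = RankTop (representative i)} {RankTop (representative j)} i≅j))
           , cover
  where
  cover : ∀ T → HasUnderlyingGraph T (Cycle 3) → ∃ λ j → Homeomorphic T (RankTop (representative j))
  cover T graph =
    let (c , c≗size) = size-code T
        (j , p , same) = representatives-cover c
    in j , ≈-homeo {T = T} {RankTop (∣_∣ ∘ down T)} {RankTop (representative j)} (triangle⇒rankTop T graph)
             (rankTop-homeo {r = ∣_∣ ∘ down T} {representative j} (lookup permutations p)
                (sameOrder-≗ {s = representative j ∘ (lookup permutations p ⟨$⟩ʳ_)} c≗size same))

-- Zigzag topologies on an even cycle: the vertices x with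
-- flips (toℕ x) b ≡ true lie below both of their neighbours.

even⇒≢1 : ∀ {N} → even N ≡ true → N ≢ 1
even⇒≢1 even-N refl = contradiction even-N λ ()

module _ {m : ℕ} where

  ZigzagLe : Bool → Fin (suc m) → Fin (suc m) → Set
  ZigzagLe b x y = x ≡ y ⊎ (Cycle (suc m) x y × flips (toℕ x) b ≡ true)

  zigzagLe? : ∀ b x y → Dec (ZigzagLe b x y)
  zigzagLe? b x y = (x ≟ y) ⊎-dec (cycle? x y ×-dec (flips (toℕ x) b ≟ᵇ true))

  Zigzag : Bool → Topology (suc m)
  Zigzag b = Alexandrov (ZigzagLe b) (zigzagLe? b)

  module _ (even-N : even (suc m) ≡ true) where

    -- ZigzagLe is transitive because adjacent vertices carry opposite labels.
    zigzag-trans : ∀ b {x y z} → ZigzagLe b x y → ZigzagLe b y z → ZigzagLe b x z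
    zigzag-trans b (inj₁ refl) y≤z = y≤z
    zigzag-trans b (inj₂ x<y) (inj₁ refl) = inj₂ x<y
    zigzag-trans b (inj₂ (c , x-low)) (inj₂ (_ , y-low)) =
      contradiction (trans (cong not (sym x-low)) (trans (sym (flips-adjacent even-N b c)) y-low)) λ ()

    spec-zigzag : ∀ b x y → Spec (Zigzag b) x y ⇔ ZigzagLe b x y
    spec-zigzag b = spec-alexandrov (ZigzagLe b) (zigzagLe? b) (λ _ → inj₁ refl) (zigzag-trans b)

    zigzag-graph : ∀ b → HasUnderlyingGraph (Zigzag b) (Cycle (suc m))
    zigzag-graph b = alexandrov-graph (ZigzagLe b) (zigzagLe? b) (λ _ → inj₁ refl) (zigzag-trans b) (Cycle (suc m))
      λ x y → mk⇔ (λ c → (λ { refl → cycle-irrefl (even⇒≢1 even-N) c }) , oriented c)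
                  λ { (x≢y , inj₁ (inj₁ x≡y)) → contradiction x≡y x≢y
                    ; (x≢y , inj₁ (inj₂ (c , _))) → c
                    ; (x≢y , inj₂ (inj₁ y≡x)) → contradiction (sym y≡x) x≢y
                    ; (x≢y , inj₂ (inj₂ (c , _))) → cycle-sym c }
      where
      -- exactly one endpoint of an edge is low
      oriented : ∀ {x y} → Cycle (suc m) x y → ZigzagLe b x y ⊎ ZigzagLe b y x
      oriented {x} {y} c with flips (toℕ x) b in x-label
      ... | true = inj₁ (inj₂ (c , refl))
      ... | false = inj₂ (inj₂ (cycle-sym c , trans (flips-adjacent even-N b c) (cong not x-label)))

    zigzag-rotate : ∀ b → Homeomorphic (Zigzag b) (Zigzag (not b))
    zigzag-rotate b = alexandrov-homeo (ZigzagLe b) (zigzagLe? b) (ZigzagLe (not b)) (zigzagLe? (not b)) rotation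
      λ x y → mk⇔ (⊎-map (cong next) (λ (c , low) → to cycle-rotate c , trans (label x) low))
                  (⊎-map next-injective (λ (c , low) → from cycle-rotate c , trans (sym (label x)) low))
      where
      label : ∀ x → flips (toℕ (next x)) (not b) ≡ flips (toℕ x) b
      label x = begin
        flips (toℕ (next x)) (not b)   ≡⟨ flips-next even-N (not b) x ⟩
        not (flips (toℕ x) (not b))    ≡⟨ cong not (flips-not (toℕ x) b) ⟩
        not (not (flips (toℕ x) b))    ≡⟨ not-involutive _ ⟩
        flips (toℕ x) b                ∎
        where open ≡-Reasoning

    -- Vertex 0 lies below its successor in one zigzag but not the other.
    zigzag-distinct : ¬ Zigzag true ≈ᵀ Zigzag false
    zigzag-distinct same with to (spec-zigzag false zero (next zero)) (≈ᵀ⇒spec {T = Zigzag true} {Zigzag false} same 0≼1)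
      where
      0≼1 : Spec (Zigzag true) zero (next zero)
      0≼1 = from (spec-zigzag true zero (next zero)) (inj₂ (cycle-next zero , refl))
    ... | inj₁ 0≡next0 = cycle-irrefl (even⇒≢1 even-N) (subst (Cycle (suc m) zero) (sym 0≡next0) (cycle-next zero))
    ... | inj₂ (_ , ())

-- Cycles of length N ≥ 4: a topology with underlying graph C_N orients each
-- edge one way, alternately up and down; hence N is even and the topology
-- is a zigzag.

module LongCycle {k : ℕ} (T : Topology (4 + k)) (graph : HasUnderlyingGraph T (Cycle (4 + k))) where

  comparable : ∀ {x y} → Cycle (4 + k) x y → Spec T x y ⊎ Spec T y x
  comparable {x} {y} c = proj₂ (from (graph x y) c)

  spec⇒cycle : ∀ {x y} → x ≢ y → Spec T x y → Cycle (4 + k) x y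
  spec⇒cycle {x} {y} x≢y x≼y = to (graph x y) (x≢y , inj₁ x≼y)

  far : ∀ x → x ≢ next (next x) × ¬ Cycle (4 + k) x (next (next x))
  far x = (λ e → too-short (inj₁ (cong toℕ e))) , (λ c → too-short (inj₂ (to cycle⇔follows c)))
    where
    too-short : ¬ (toℕ x ≡ toℕ (next (next x)) ⊎ Follows (4 + k) (toℕ x) (toℕ (next (next x)))
                                               ⊎ Follows (4 + k) (toℕ (next (next x))) (toℕ x))
    too-short close with two-steps (next-follows x) (next-follows (next x)) close
    ... | s≤s (s≤s (s≤s ()))

  not-two-up : ∀ x → Spec T x (next x) → ¬ Spec T (next x) (next (next x))
  not-two-up x up₁ up₂ = proj₂ (far x) (spec⇒cycle (proj₁ (far x)) (spec-trans T up₁ up₂))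

  not-two-down : ∀ x → Spec T (next (next x)) (next x) → ¬ Spec T (next x) x
  not-two-down x down₂ down₁ =
    proj₂ (far x) (cycle-sym (spec⇒cycle (proj₁ (far x) ∘ sym) (spec-trans T down₂ down₁)))

  edge-antisym : ∀ x → Spec T x (next x) → ¬ Spec T (next x) x
  edge-antisym x up down with comparable (cycle-next (next x))
  ... | inj₁ up′ = not-two-up x up up′
  ... | inj₂ down′ = not-two-down x down′ down

  not-up⇒down : ∀ x → ¬ Spec T x (next x) → Spec T (next x) x
  not-up⇒down x ¬up with comparable (cycle-next x)
  ... | inj₁ up = contradiction up ¬up
  ... | inj₂ down = down

  up : Fin (4 + k) → Bool
  up x = does (spec? T x (next x))

  up-alternating : Alternating up
  up-alternating x with spec? T x (next x) | spec? T (next x) (next (next x))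
  ... | yes up₁ | yes up₂ = contradiction up₂ (not-two-up x up₁)
  ... | yes _   | no _    = refl
  ... | no _    | yes _   = refl
  ... | no ¬up₁ | no ¬up₂ = contradiction (not-up⇒down x ¬up₁) (not-two-down x (not-up⇒down (next x) ¬up₂))

  up-next⇔ : ∀ x → up (next x) ≡ true ⇔ (¬ Spec T x (next x))
  up-next⇔ x = mk⇔
    (λ up-next up-x → contradiction (subst (λ b → not b ≡ true) (dec-true (spec? T x (next x)) up-x)
                                           (trans (sym (up-alternating x)) up-next)) λ ())
    (λ ¬up-x → trans (up-alternating x) (cong not (dec-false (spec? T x (next x)) ¬up-x)))

  even-length : even (4 + k) ≡ true
  even-length = alternating⇒even up-alternating

  up≡label : ∀ x → up x ≡ flips (toℕ x) (up zero)
  up≡label = alternating-labels up-alternating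

  spec⇔zigzag : ∀ x y → Spec T x y ⇔ ZigzagLe (up zero) x y
  spec⇔zigzag x y = mk⇔ (spec⇒zigzag x y) (zigzag⇒spec x y)
    where
    spec⇒zigzag : ∀ x y → Spec T x y → ZigzagLe (up zero) x y
    spec⇒zigzag x y x≼y with x ≟ y
    ... | yes x≡y = inj₁ x≡y
    ... | no x≢y with spec⇒cycle x≢y x≼y
    ...   | c with cycle⇒next c
    ...     | inj₁ refl = inj₂ (c , trans (sym (up≡label x)) (dec-true (spec? T x (next x)) x≼y))
    ...     | inj₂ refl = inj₂ (c , trans (sym (up≡label x)) (from (up-next⇔ y) λ up-y → edge-antisym y up-y x≼y))
    zigzag⇒spec : ∀ x y → ZigzagLe (up zero) x y → Spec T x y
    zigzag⇒spec x y (inj₁ refl) = spec-refl T x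
    zigzag⇒spec x y (inj₂ (c , low)) with cycle⇒next c
    ... | inj₁ refl = to (does⇔ (spec? T x (next x))) (trans (up≡label x) low)
    ... | inj₂ refl = not-up⇒down y (to (up-next⇔ y) (trans (up≡label x) low))

  classification : T ≈ᵀ Zigzag (up zero)
  classification = ≈alexandrov T (ZigzagLe (up zero)) (zigzagLe? (up zero)) spec⇔zigzag

long-odd-cycle : ∀ {k} → even (4 + k) ≡ false → TauBar (Cycle (4 + k)) 0 × HBar (Cycle (4 + k)) 0
long-odd-cycle {k} odd = count-none {_~_ = _≈ᵀ_} no-topology , count-none {_~_ = Homeomorphic} no-topology
  where
  no-topology : ∀ T → ¬ HasUnderlyingGraph T (Cycle (4 + k))
  no-topology T graph = contradiction (trans (sym (LongCycle.even-length T graph)) odd) λ ()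

long-even-cycle : ∀ {k} → even (4 + k) ≡ true → TauBar (Cycle (4 + k)) 2 × HBar (Cycle (4 + k)) 1
long-even-cycle {k} even-N =
    count-two {P = HasCycleGraph} {_~_ = _≈ᵀ_} {a = Zigzag true} {b = Zigzag false}
              (zigzag-graph′ true) (zigzag-graph′ false)
              (zigzag-distinct {m = 3 + k} even-N)
              (zigzag-distinct {m = 3 + k} even-N ∘ ≈ᵀ-sym {T = Zigzag false} {Zigzag true})
              (λ T graph → either-zigzag {T} (LongCycle.up T graph zero) (LongCycle.classification T graph))
  , count-one {P = HasCycleGraph} {_~_ = Homeomorphic} {a = Zigzag true} (zigzag-graph′ true)
              (λ T graph → homeo-zigzag {T} (LongCycle.up T graph zero) (LongCycle.classification T graph))
  where
  HasCycleGraph : Topology (4 + k) → Set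
  HasCycleGraph T = HasUnderlyingGraph T (Cycle (4 + k))
  zigzag-graph′ : ∀ b → HasCycleGraph (Zigzag b)
  zigzag-graph′ = zigzag-graph {m = 3 + k} even-N
  either-zigzag : ∀ {T : Topology (4 + k)} b → T ≈ᵀ Zigzag b → T ≈ᵀ Zigzag true ⊎ T ≈ᵀ Zigzag false
  either-zigzag true T≈ = inj₁ T≈
  either-zigzag false T≈ = inj₂ T≈
  homeo-zigzag : ∀ {T : Topology (4 + k)} b → T ≈ᵀ Zigzag b → Homeomorphic T (Zigzag true)
  homeo-zigzag {T} true T≈ = ≈-homeo {T = T} {Zigzag true} {Zigzag true} T≈ (homeo-refl (Zigzag true))
  homeo-zigzag {T} false T≈ = ≈-homeo {T = T} {Zigzag false} {Zigzag true} T≈ (zigzag-rotate {m = 3 + k} even-N false)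

-- byCases tests oddness as n % 2 ≡ᵇ 1.
odd≡not-even : ∀ n → (n % 2 ≡ᵇ 1) ≡ not (even n)
odd≡not-even 0 = refl
odd≡not-even 1 = refl
odd≡not-even (suc (suc n)) = trans (odd≡not-even n) (cong not (sym (not-involutive (even n))))

corollary4p1 : (n : ℕ) → 3 ≤ n →
    TauBar (Cycle n) (byCases 13 0 2 n) × HBar (Cycle n) (byCases 4 0 1 n)
corollary4p1 0 ()
corollary4p1 1 (s≤s ())
corollary4p1 2 (s≤s (s≤s ()))
corollary4p1 3 _ = triangle-τ , triangle-ħ
corollary4p1 (suc (suc (suc (suc k)))) _ rewrite odd≡not-even (4 + k) with even (4 + k) in parity
... | true = long-even-cycle parity
... | false = long-odd-cycle parity
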